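{- Let $G$ be a graph of order $n$ with adjacency matrix $\mathbf{A}$, and consider the binary linear program: maximize $\eta(\mathbf{x})=\sum_{j\in V(G)}x_j$ subject to $(\mathbf{A}+\mathbf{I}_n)\mathbf{x}\le\mathbf{d}$ and $\mathbf{x}\in\{0,1\}^n$, where $\mathbf{I}_n$ is the identity matrix of order $n$ and $\mathbf{d}$ is the vector of vertex degrees of $G$. If $\mathbf{x}^*$ is an optimal solution with components $x^*_j$, then $D^*=\{j\mid x^*_j=0\}$ is a minimum dominating set of $G$ and $\gamma(G)=n-\eta(\mathbf{x}^*)$.
   Context: A dominating set of $G$ is a set $S\subseteq V(G)$ such that every vertex is in $S$ or adjacent to a vertex of $S$; $\gamma(G)$ is the minimum size of a dominating set. -}

module Defs where

open import Data.Nat using (ℕ; zero; suc; _+_; _*_; _≤_)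
open import Data.Bool using (Bool; true; false; not)
open import Data.Fin using (Fin; _≟_)
open import Data.Fin.Subset using (Subset; _∈_; ∣_∣)
open import Data.Vec using (tabulate)
import Data.Vec as V
open import Data.Product using (_×_; ∃)
open import Data.Sum using (_⊎_)
open import Relation.Binary.PropositionalEquality using (_≡_)
open import Relation.Nullary using (does)

record Graph (n : ℕ) : Set where
  field
    adj   : Fin n → Fin n → Bool
    sym   : ∀ i j → adj i j ≡ adj j i
    loopless : ∀ i → adj i i ≡ false
open Graph public

sumFin : ∀ {n} → (Fin n → ℕ) → ℕ
sumFin f = V.sum (tabulate f)

bit : Bool → ℕ
bit true  = 1
bit false = 0

A : ∀ {n} → Graph n → Fin n → Fin n → ℕ
A G i j = bit (adj G i j)

I : ∀ {n} → Fin n → Fin n → ℕ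
I i j = bit (does (i ≟ j))

deg : ∀ {n} → Graph n → Fin n → ℕ
deg G i = sumFin (λ j → A G i j)

BinVec : ℕ → Set
BinVec n = Fin n → Bool

η : ∀ {n} → BinVec n → ℕ
η x = sumFin (λ j → bit (x j))

Feasible : ∀ {n} → Graph n → BinVec n → Set
Feasible G x = ∀ i → sumFin (λ j → (A G i j + I i j) * bit (x j)) ≤ deg G i

Optimal : ∀ {n} → Graph n → BinVec n → Set
Optimal G x = Feasible G x × (∀ y → Feasible G y → η y ≤ η x)

zeroSet : ∀ {n} → BinVec n → Subset n
zeroSet x = tabulate (λ j → not (x j))

Dominating : ∀ {n} → Graph n → Subset n → Set
Dominating G S = ∀ v → v ∈ S ⊎ ∃ (λ u → u ∈ S × adj G u v ≡ true)

MinimumDominating : ∀ {n} → Graph n → Subset n → Set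
MinimumDominating G D = Dominating G D × (∀ S → Dominating G S → ∣ D ∣ ≤ ∣ S ∣)

DominationNumber : ∀ {n} → Graph n → ℕ → Set
DominationNumber G k =
  ∃ (λ S → Dominating G S × ∣ S ∣ ≡ k) × (∀ S → Dominating G S → k ≤ ∣ S ∣)

{-# OPTIONS --safe #-}
module Submission where

-- For a binary x, row i of (A + I) x ≤ d reads  N + x_i ≤ N + Z,  where N and Z count the
-- neighbours j of i with x_j = 1 and x_j = 0 respectively.  So the row says exactly that i is
-- dominated by D = {j | x_j = 0}: feasible vectors are the complements of dominating sets,
-- |D| = n − η(x), and maximising η is minimising |D|.

open import Defs hiding (sym)
open import Data.Bool using (true; false; not)
open import Data.Bool.Properties using (not-involutive; not-injective)
open import Data.Fin using (Fin; zero; suc)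
open import Data.Fin.Subset using (Subset; _∈_; ∣_∣)
open import Data.Nat using (ℕ; zero; suc; _+_; _*_; _∸_; _≤_; _<_; z≤n; s≤s; z<s)
open import Data.Nat.Properties
  using (+-0-commutativeMonoid; +-suc; +-identityʳ; *-identityˡ; *-distribʳ-+; *-distribˡ-+;
         *-identityʳ; +-cancelˡ-≤; +-monoʳ-≤; m≤m+n; m≤n+m; m+n∸n≡m; ∸-monoʳ-≤; ≤-trans;
         module ≤-Reasoning)
open import Algebra.Properties.CommutativeMonoid.Sum +-0-commutativeMonoid
  using (sum; sum-cong-≗; ∑-distrib-+; sum-replicate-zero)
open import Data.Product using (_×_; _,_; ∃)
open import Data.Sum using (_⊎_; inj₁; inj₂)
open import Data.Vec using (lookup)
open import Data.Vec.Properties using (lookup∘tabulate; tabulate-cong; tabulate∘lookup; []=⇒lookup; lookup⇒[]=)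
open import Function using (_∘_)
open import Function.Bundles using (_⇔_; mk⇔; Equivalence)
open import Function.Construct.Composition using (_⇔-∘_)
open import Relation.Binary.PropositionalEquality

sumFin≡sum : ∀ {n} (f : Fin n → ℕ) → sumFin f ≡ sum f
sumFin≡sum {zero}  f = refl
sumFin≡sum {suc n} f = cong (f zero +_) (sumFin≡sum (f ∘ suc))

sumFin-cong : ∀ {n} {f g : Fin n → ℕ} → f ≗ g → sumFin f ≡ sumFin g
sumFin-cong {f = f} {g} f≗g = begin
  sumFin f  ≡⟨ sumFin≡sum f ⟩
  sum f     ≡⟨ sum-cong-≗ f≗g ⟩
  sum g     ≡⟨ sumFin≡sum g ⟨
  sumFin g  ∎
  where open ≡-Reasoning

sumFin-distrib-+ : ∀ {n} (f g : Fin n → ℕ) → sumFin (λ j → f j + g j) ≡ sumFin f + sumFin g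
sumFin-distrib-+ f g = begin
  sumFin (λ j → f j + g j)  ≡⟨ sumFin≡sum (λ j → f j + g j) ⟩
  sum (λ j → f j + g j)     ≡⟨ ∑-distrib-+ f g ⟩
  sum f + sum g             ≡⟨ cong₂ _+_ (sumFin≡sum f) (sumFin≡sum g) ⟨
  sumFin f + sumFin g       ∎
  where open ≡-Reasoning

sumFin-zero : ∀ n → sumFin {n} (λ _ → 0) ≡ 0
sumFin-zero n = trans (sumFin≡sum {n} (λ _ → 0)) (sum-replicate-zero n)

sumFin-I : ∀ {n} (i : Fin n) (c : Fin n → ℕ) → sumFin (λ j → I i j * c j) ≡ c i
sumFin-I {suc n} zero c = trans (cong₂ _+_ (*-identityˡ (c zero)) (sumFin-zero n)) (+-identityʳ (c zero))
sumFin-I (suc i)    c = sumFin-I i (c ∘ suc)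

term≤sumFin : ∀ {n} (f : Fin n → ℕ) (j : Fin n) → f j ≤ sumFin f
term≤sumFin f zero    = m≤m+n (f zero) _
term≤sumFin f (suc j) = ≤-trans (term≤sumFin (f ∘ suc) j) (m≤n+m _ (f zero))

sumFin-positive : ∀ {n} (f : Fin n → ℕ) → 0 < sumFin f → ∃ λ j → 0 < f j
sumFin-positive {zero}  f ()
sumFin-positive {suc n} f pos with f zero in eq
... | suc _ = zero , subst (0 <_) (sym eq) z<s
... | zero with sumFin-positive (f ∘ suc) pos
...   | j , p = suc j , p

bit≤1 : ∀ b → bit b ≤ 1
bit≤1 true  = s≤s z≤n
bit≤1 false = z≤n

bit+bit-not : ∀ b → bit b + bit (not b) ≡ 1
bit+bit-not true  = refl
bit+bit-not false = refl

positive-bit*bit-not : ∀ a b → 0 < bit a * bit (not b) → a ≡ true × b ≡ false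
positive-bit*bit-not true false _ = refl , refl

∣zeroSet∣+η : ∀ {n} (x : BinVec n) → ∣ zeroSet x ∣ + η x ≡ n
∣zeroSet∣+η {zero}  x = refl
∣zeroSet∣+η {suc n} x with x zero
... | true  = trans (+-suc _ _) (cong suc (∣zeroSet∣+η (x ∘ suc)))
... | false = cong suc (∣zeroSet∣+η (x ∘ suc))

∣zeroSet∣≡n∸η : ∀ {n} (x : BinVec n) → ∣ zeroSet x ∣ ≡ n ∸ η x
∣zeroSet∣≡n∸η x = trans (sym (m+n∸n≡m _ (η x))) (cong (_∸ η x) (∣zeroSet∣+η x))

∈zeroSet⇔ : ∀ {n} (x : BinVec n) (u : Fin n) → u ∈ zeroSet x ⇔ x u ≡ false
∈zeroSet⇔ x u = mk⇔
  (λ u∈ → not-injective (trans (sym (lookup∘tabulate (not ∘ x) u)) ([]=⇒lookup u∈)))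
  (λ xu≡0 → lookup⇒[]= u (zeroSet x) (trans (lookup∘tabulate (not ∘ x) u) (cong not xu≡0)))

complement : ∀ {n} → Subset n → BinVec n
complement S j = not (lookup S j)

zeroSet-complement : ∀ {n} (S : Subset n) → zeroSet (complement S) ≡ S
zeroSet-complement S = trans (tabulate-cong (not-involutive ∘ lookup S)) (tabulate∘lookup S)

zeroNeighbours : ∀ {n} → Graph n → BinVec n → Fin n → ℕ
zeroNeighbours G x i = sumFin (λ j → A G i j * bit (not (x j)))

DominatedByZeros : ∀ {n} → Graph n → BinVec n → Fin n → Set
DominatedByZeros G x i = x i ≡ false ⊎ ∃ λ j → adj G i j ≡ true × x j ≡ false

module _ {n} (G : Graph n) (x : BinVec n) (i : Fin n) where

  private
    oneNeighbours : ℕ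
    oneNeighbours = sumFin (λ j → A G i j * bit (x j))

  constraint-split : sumFin (λ j → (A G i j + I i j) * bit (x j)) ≡ oneNeighbours + bit (x i)
  constraint-split = begin
    sumFin (λ j → (A G i j + I i j) * bit (x j))
      ≡⟨ sumFin-cong (λ j → *-distribʳ-+ (bit (x j)) (A G i j) (I i j)) ⟩
    sumFin (λ j → A G i j * bit (x j) + I i j * bit (x j))
      ≡⟨ sumFin-distrib-+ (λ j → A G i j * bit (x j)) (λ j → I i j * bit (x j)) ⟩
    oneNeighbours + sumFin (λ j → I i j * bit (x j))
      ≡⟨ cong (oneNeighbours +_) (sumFin-I i (bit ∘ x)) ⟩
    oneNeighbours + bit (x i)
      ∎
    where open ≡-Reasoning

  deg-split : deg G i ≡ oneNeighbours + zeroNeighbours G x i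
  deg-split = begin
    sumFin (λ j → A G i j)
      ≡⟨ sumFin-cong (λ j → sym (*-identityʳ (A G i j))) ⟩
    sumFin (λ j → A G i j * 1)
      ≡⟨ sumFin-cong (λ j → cong (A G i j *_) (sym (bit+bit-not (x j)))) ⟩
    sumFin (λ j → A G i j * (bit (x j) + bit (not (x j))))
      ≡⟨ sumFin-cong (λ j → *-distribˡ-+ (A G i j) (bit (x j)) (bit (not (x j)))) ⟩
    sumFin (λ j → A G i j * bit (x j) + A G i j * bit (not (x j)))
      ≡⟨ sumFin-distrib-+ (λ j → A G i j * bit (x j)) (λ j → A G i j * bit (not (x j))) ⟩
    oneNeighbours + zeroNeighbours G x i
      ∎
    where open ≡-Reasoning

  constraint⇔bit≤zeroNeighbours :
    sumFin (λ j → (A G i j + I i j) * bit (x j)) ≤ deg G i ⇔ bit (x i) ≤ zeroNeighbours G x i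
  constraint⇔bit≤zeroNeighbours = mk⇔
    (λ row → +-cancelˡ-≤ oneNeighbours _ _ (subst₂ _≤_ constraint-split deg-split row))
    (λ le → subst₂ _≤_ (sym constraint-split) (sym deg-split) (+-monoʳ-≤ oneNeighbours le))

  bit≤zeroNeighbours⇔ :
    bit (x i) ≤ zeroNeighbours G x i ⇔ DominatedByZeros G x i
  bit≤zeroNeighbours⇔ = mk⇔ to from
    where
    to : bit (x i) ≤ zeroNeighbours G x i → DominatedByZeros G x i
    to le with x i
    ... | false = inj₁ refl
    ... | true with sumFin-positive _ le
    ...   | j , p = inj₂ (j , positive-bit*bit-not (adj G i j) (x j) p)

    from : DominatedByZeros G x i → bit (x i) ≤ zeroNeighbours G x i
    from (inj₁ xi≡0) = subst (λ b → bit b ≤ zeroNeighbours G x i) (sym xi≡0) z≤n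
    from (inj₂ (j , aij , xj≡0)) = begin
      bit (x i)                    ≤⟨ bit≤1 (x i) ⟩
      1                            ≡⟨ cong₂ (λ a b → bit a * bit (not b)) aij xj≡0 ⟨
      A G i j * bit (not (x j))    ≤⟨ term≤sumFin _ j ⟩
      zeroNeighbours G x i         ∎
      where open ≤-Reasoning

  constraint⇔dominatedByZeros :
    sumFin (λ j → (A G i j + I i j) * bit (x j)) ≤ deg G i ⇔ DominatedByZeros G x i
  constraint⇔dominatedByZeros = bit≤zeroNeighbours⇔ ⇔-∘ constraint⇔bit≤zeroNeighbours

feasible⇔dominating : ∀ {n} (G : Graph n) (x : BinVec n) → Feasible G x ⇔ Dominating G (zeroSet x)
feasible⇔dominating G x = mk⇔
  (λ feasible v → dominated v (to (constraint⇔dominatedByZeros G x v) (feasible v)))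
  (λ dom i → from (constraint⇔dominatedByZeros G x i) (undominated i (dom i)))
  where
  open Equivalence
  dominated : ∀ v → DominatedByZeros G x v → v ∈ zeroSet x ⊎ ∃ λ u → u ∈ zeroSet x × adj G u v ≡ true
  dominated v (inj₁ xv≡0)             = inj₁ (from (∈zeroSet⇔ x v) xv≡0)
  dominated v (inj₂ (u , avu , xu≡0)) = inj₂ (u , from (∈zeroSet⇔ x u) xu≡0 , trans (Graph.sym G u v) avu)

  undominated : ∀ i → i ∈ zeroSet x ⊎ (∃ λ u → u ∈ zeroSet x × adj G u i ≡ true) → DominatedByZeros G x i
  undominated i (inj₁ i∈)             = inj₁ (to (∈zeroSet⇔ x i) i∈)
  undominated i (inj₂ (u , u∈ , aui)) = inj₂ (u , trans (Graph.sym G i u) aui , to (∈zeroSet⇔ x u) u∈)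

optimal⇒minimumDominating : ∀ {n} (G : Graph n) (x : BinVec n) → Optimal G x → MinimumDominating G (zeroSet x)
optimal⇒minimumDominating {n} G x (feasible , maximal) = Equivalence.to (feasible⇔dominating G x) feasible , minimal
  where
  minimal : ∀ S → Dominating G S → ∣ zeroSet x ∣ ≤ ∣ S ∣
  minimal S dom = begin
    ∣ zeroSet x ∣              ≡⟨ ∣zeroSet∣≡n∸η x ⟩
    n ∸ η x                    ≤⟨ ∸-monoʳ-≤ n (maximal (complement S) complement-feasible) ⟩
    n ∸ η (complement S)       ≡⟨ ∣zeroSet∣≡n∸η (complement S) ⟨
    ∣ zeroSet (complement S) ∣ ≡⟨ cong ∣_∣ (zeroSet-complement S) ⟩
    ∣ S ∣                      ∎
    where
    open ≤-Reasoning
    complement-feasible : Feasible G (complement S)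
    complement-feasible = Equivalence.from (feasible⇔dominating G (complement S))
                            (subst (Dominating G) (sym (zeroSet-complement S)) dom)

minimumDominating⇒dominationNumber : ∀ {n} (G : Graph n) (D : Subset n) → MinimumDominating G D → DominationNumber G ∣ D ∣
minimumDominating⇒dominationNumber G D (dom , minimal) = (D , dom , refl) , minimal

theorem6 : (n : ℕ) (G : Graph n) (x : BinVec n) → Optimal G x → MinimumDominating G (zeroSet x) × DominationNumber G (n ∸ η x)
theorem6 n G x opt =
  minimum , subst (DominationNumber G) (∣zeroSet∣≡n∸η x) (minimumDominating⇒dominationNumber G (zeroSet x) minimum)
  where
  minimum : MinimumDominating G (zeroSet x)
  minimum = optimal⇒minimumDominating G x opt
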